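{- Let $r\ge 2$ and let $GT(r)$ be the glued binary tree obtained from two copies $T_r^{(1)}$, $T_r^{(2)}$ of the perfect binary tree of depth $r$ by identifying each leaf of $T_r^{(1)}$ with the corresponding leaf of $T_r^{(2)}$. For each $i\in\{1,2\}$, the subgraph of $GT(r)$ induced by $V(T_r^{(i)})$ is an isometric subgraph of $GT(r)$. Moreover, if $u,v\in V(T_r^{(i)})$ are distinct, then there are exactly two shortest $u,v$-paths in $GT(r)$ if both $u$ and $v$ are quasi-leaves, and otherwise the shortest $u,v$-path in $GT(r)$ is unique.
   Context: A perfect binary tree of depth $r\ge1$ is a rooted tree in which every non-leaf vertex has exactly $2$ children and all leaves have depth $r$. The glued binary tree $GT(r)$ is formed from two copies $T_r^{(1)}$ and $T_r^{(2)}$ of it by identifying the leaves pairwise via the natural isomorphism between the two copies (each leaf of the first copy is identified with the leaf in the same position of the second copy). The identified vertices are called quasi-leaves; the set of quasi-leaves is $V(T_r^{(1)})\cap V(T_r^{(2)})$. A subgraph $H$ of $G$ is isometric if $d_H(u,v)=d_G(u,v)$ for all $u,v\in V(H)$. -}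

module Defs where

open import Level using (Level; _⊔_) renaming (suc to lsuc)
open import Data.Nat using (ℕ; zero; suc; _≤_; _<_; _∸_)
open import Data.Bool using (Bool)
open import Data.Fin using (Fin)
open import Data.List using (List; []; _∷_; length)
open import Data.Vec using (Vec; toList)
open import Data.Product using (Σ; ∃; _×_; _,_; proj₁)
open import Data.Sum using (_⊎_)
open import Relation.Nullary using (¬_)
open import Relation.Binary.PropositionalEquality using (_≡_; _≢_)
open import Data.List.Relation.Unary.Unique.Propositional using (Unique)
open import Function.Bundles using (_⇔_)

record Graph : Set₁ where
  field
    V : Set
    E : V → V → Set
open Graph public

data WalkL (G : Graph) : V G → V G → List (V G) → Set where
  single : ∀ u → WalkL G u u (u ∷ [])
  step   : ∀ {u w v xs} → E G u w → WalkL G w v xs → WalkL G u v (u ∷ xs)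

edges : ∀ {A : Set} → List A → ℕ
edges xs = length xs ∸ 1

IsPath : (G : Graph) → V G → V G → List (V G) → Set
IsPath G u v xs = WalkL G u v xs × Unique xs

Dist : (G : Graph) → V G → V G → ℕ → Set
Dist G u v d =
  (∃ λ xs → WalkL G u v xs × edges xs ≡ d) ×
  (∀ xs → WalkL G u v xs → d ≤ edges xs)

IsShortestPath : (G : Graph) → V G → V G → List (V G) → Set
IsShortestPath G u v xs = IsPath G u v xs × Dist G u v (edges xs)

Induced : (G : Graph) → (V G → Set) → Graph
Induced G P = record { V = Σ (V G) P ; E = λ x y → E G (proj₁ x) (proj₁ y) }

IsIsometricInduced : (G : Graph) → (V G → Set) → Set
IsIsometricInduced G P =
  ∀ (x y : V (Induced G P)) (d : ℕ) →
    Dist (Induced G P) x y d ⇔ Dist G (proj₁ x) (proj₁ y) d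

ExactlyTwoShortest : (G : Graph) → V G → V G → Set
ExactlyTwoShortest G u v =
  ∃ λ p → ∃ λ q → p ≢ q × IsShortestPath G u v p × IsShortestPath G u v q ×
    (∀ s → IsShortestPath G u v s → s ≡ p ⊎ s ≡ q)

UniqueShortest : (G : Graph) → V G → V G → Set
UniqueShortest G u v =
  ∃ λ p → IsShortestPath G u v p × (∀ s → IsShortestPath G u v s → s ≡ p)

-- A vertex of the perfect binary tree T_r of depth r is a binary word w
-- with length w ≤ r (root = [], children of w are b ∷ w, leaves = words of
-- length r).  GT(r): non-leaf vertices of copy i ∈ Fin 2 are  node i w
-- (length w < r); the quasi-leaves (identified leaves) are  leaf v, v a
-- word of length r, shared by both copies.

data GTV (r : ℕ) : Set where
  node : (i : Fin 2) (w : List Bool) → length w < r → GTV r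
  leaf : Vec Bool r → GTV r

data Child {r : ℕ} : GTV r → GTV r → Set where
  nn : ∀ i b w p q → Child (node i w p) (node i (b ∷ w) q)
  nl : ∀ i b w p (v : Vec Bool r) → toList v ≡ b ∷ w → Child (node i w p) (leaf v)

GT : ℕ → Graph
GT r = record { V = GTV r ; E = λ x y → Child x y ⊎ Child y x }

data InCopy {r : ℕ} (i : Fin 2) : GTV r → Set where
  inNode : ∀ w p → InCopy i (node i w p)
  inLeaf : ∀ v → InCopy i (leaf v)

data QuasiLeaf {r : ℕ} : GTV r → Set where
  ql : ∀ v → QuasiLeaf (leaf v)

{-# OPTIONS --safe #-}
module Submission where

-- Reading a vertex of GT(r) as the root-first binary word of its position maps every edge to an
-- edge of the infinite binary word tree, so the tree distance of the words bounds the length of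
-- every walk from below; inside either copy one can always step towards the target, so the bound
-- is attained and is the distance both in GT(r) and in each copy. In the word tree the step that
-- decreases the distance is unique, so all geodesics between two vertices have the same word
-- sequence. A geodesic never passes through a quasi-leaf (its two neighbours carry the same word),
-- so it stays in one copy, where a vertex is determined by its word. Hence the geodesic is unique
-- unless both ends are quasi-leaves, in which case there is exactly one through each copy.

open import Defs
open import Data.Bool using (Bool; true; false)
open import Data.Empty using (⊥-elim)
open import Data.Fin using (Fin)
open import Data.Fin.Patterns using (0F; 1F)
open import Data.List using (List; []; _∷_; _++_; _∷ʳ_; length; reverse; map; initLast; _∷ʳ′_)
open import Data.List.Properties
  using (length-map; length-++; length-++-≤ˡ; length-reverse; ∷-injectiveˡ; ∷-injectiveʳ; ++-cancelˡ;
         ∷ʳ-++; ∷ʳ-injectiveˡ; unfold-reverse; reverse-involutive; reverse-injective)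
open import Data.List.Membership.Propositional using (_∈_; _∉_)
open import Data.List.Relation.Unary.All using (All; []; _∷_; universal)
open import Data.List.Relation.Unary.All.Properties using (¬Any⇒All¬; map⁺)
open import Data.List.Relation.Unary.AllPairs using ([]; _∷_)
open import Data.List.Relation.Unary.Any using (here; there)
open import Data.List.Relation.Unary.Unique.Propositional using (Unique)
open import Data.Nat using (ℕ; zero; suc; _+_; _∸_; _≤_; _<_; s≤s; s≤s⁻¹)
open import Data.Nat.Properties
  using (≤-refl; ≤-reflexive; ≤-trans; ≤-antisym; n≤1+n; 1+n≰n; 1+n≢0; m+1+n≢n; +-comm; suc-injective;
         ≤-irrelevant; m≤n⇒m<n∨m≡n; module ≤-Reasoning)
open import Data.Product using (∃; ∃₂; _×_; _,_; proj₁; proj₂)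
open import Data.Sum using (_⊎_; inj₁; inj₂)
import Data.Sum as Sum
open import Data.Vec using (Vec; toList; fromList)
open import Data.Vec.Properties using (toList-injective; toList∘fromList; length-toList; cast-is-id)
open import Function using (id; _∘_)
open import Function.Bundles using (_⇔_; mk⇔; Equivalence)
import Function.Properties.Equivalence as ⇔
open import Relation.Binary.PropositionalEquality
  using (_≡_; _≢_; refl; sym; trans; cong; cong₂; subst; module ≡-Reasoning)
open import Relation.Nullary using (¬_)

module _ {G : Graph} where

  edges-∷ : ∀ {x y xs} u → WalkL G x y xs → edges (u ∷ xs) ≡ suc (edges xs)
  edges-∷ u (single _) = refl
  edges-∷ u (step _ _) = refl

  All-target : ∀ {P : V G → Set} {x y xs} → WalkL G x y xs → All P xs → P y
  All-target (single _) (py ∷ []) = py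
  All-target (step _ w) (_ ∷ ps)  = All-target w ps

  walk-from : ∀ {x y z xs} → WalkL G x y xs → z ∈ xs → ∃ λ ys → WalkL G z y ys × edges ys ≤ edges xs
  walk-from w@(single _) (here refl) = _ , w , ≤-refl
  walk-from w@(step _ _) (here refl) = _ , w , ≤-refl
  walk-from {x} (step _ w) (there z∈xs) with walk-from w z∈xs
  ... | ys , w′ , ys≤xs = ys , w′ , ≤-trans ys≤xs (≤-trans (n≤1+n _) (≤-reflexive (sym (edges-∷ x w))))

walk-map : ∀ {G H : Graph} (f : V G → V H) → (∀ {x y} → E G x y → E H (f x) (f y)) →
           ∀ {x y xs} → WalkL G x y xs → WalkL H (f x) (f y) (map f xs)
walk-map f f-edge (single x) = single (f x)
walk-map f f-edge (step e w) = step (f-edge e) (walk-map f f-edge w)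

edges-map : ∀ {A B : Set} (f : A → B) xs → edges (map f xs) ≡ edges xs
edges-map f xs = cong (_∸ 1) (length-map f xs)

map-injectiveOn : ∀ {A B : Set} {P : A → Set} (f : A → B) → (∀ {a b} → P a → P b → f a ≡ f b → a ≡ b) →
                  ∀ {xs ys} → All P xs → All P ys → map f xs ≡ map f ys → xs ≡ ys
map-injectiveOn f inj [] [] _ = refl
map-injectiveOn f inj (pa ∷ pas) (pb ∷ pbs) eq =
  cong₂ _∷_ (inj pa pb (∷-injectiveˡ eq)) (map-injectiveOn f inj pas pbs (∷-injectiveʳ eq))

-- A δ that vanishes on the diagonal and changes by at most one along edges bounds every walk from below;
-- once some walk attains it, δ is the distance and the walks of length δ are exactly the shortest paths.
module Geodesics (G : Graph) (δ : V G → V G → ℕ)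
                 (δ-refl : ∀ x → δ x x ≡ 0)
                 (δ-edge : ∀ {x z} t → E G x z → δ x t ≤ suc (δ z t)) where

  δ≤edges : ∀ {x y xs} → WalkL G x y xs → δ x y ≤ edges xs
  δ≤edges (single x) = ≤-reflexive (δ-refl x)
  δ≤edges {x} {y} (step {w = z} {xs = xs} e w) = begin
    δ x y            ≤⟨ δ-edge y e ⟩
    suc (δ z y)      ≤⟨ s≤s (δ≤edges w) ⟩
    suc (edges xs)   ≡⟨ sym (edges-∷ x w) ⟩
    edges (x ∷ xs)   ∎
    where open ≤-Reasoning

  Geodesic : V G → V G → List (V G) → Set
  Geodesic x y xs = WalkL G x y xs × edges xs ≡ δ x y

  geodesic-tail : ∀ {x z y xs} → E G x z → WalkL G z y xs → edges (x ∷ xs) ≡ δ x y →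
                  suc (δ z y) ≡ δ x y × edges xs ≡ δ z y
  geodesic-tail {x} {z} {y} {xs} e w g = trans (cong suc (sym tail-length)) walk-length , tail-length
    where
    walk-length : suc (edges xs) ≡ δ x y
    walk-length = trans (sym (edges-∷ x w)) g
    tail-length : edges xs ≡ δ z y
    tail-length = ≤-antisym (s≤s⁻¹ (subst (_≤ suc (δ z y)) (sym walk-length) (δ-edge y e))) (δ≤edges w)

  geodesic⇒Unique : ∀ {x y xs} → Geodesic x y xs → Unique xs
  geodesic⇒Unique (single _ , _) = [] ∷ []
  geodesic⇒Unique {x} {y} (step {w = z} {xs = xs} e w , g) with geodesic-tail e w g
  ... | descends , tail-length = ¬Any⇒All¬ xs x∉xs ∷ geodesic⇒Unique (w , tail-length)
    where
    x∉xs : x ∉ xs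
    x∉xs x∈xs with walk-from w x∈xs
    ... | ys , w′ , ys≤xs = 1+n≰n (begin
      suc (δ z y) ≡⟨ descends ⟩
      δ x y       ≤⟨ δ≤edges w′ ⟩
      edges ys    ≤⟨ ys≤xs ⟩
      edges xs    ≡⟨ tail-length ⟩
      δ z y       ∎)
      where open ≤-Reasoning

  Dist⇔δ : ∀ {x y xs d} → Geodesic x y xs → Dist G x y d ⇔ d ≡ δ x y
  Dist⇔δ (w , g) = mk⇔
    (λ { ((_ , w′ , refl) , minimal) → ≤-antisym (≤-trans (minimal _ w) (≤-reflexive g)) (δ≤edges w′) })
    (λ { refl → (_ , w , g) , λ _ → δ≤edges })

  geodesic⇒shortest : ∀ {x y xs} → Geodesic x y xs → IsShortestPath G x y xs
  geodesic⇒shortest γ@(w , g) = (w , geodesic⇒Unique γ) , Equivalence.from (Dist⇔δ γ) g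

  shortest⇒geodesic : ∀ {x y xs ys} → Geodesic x y ys → IsShortestPath G x y xs → Geodesic x y xs
  shortest⇒geodesic γ ((w , _) , dist) = w , Equivalence.to (Dist⇔δ γ) dist

  closed-walk-not-geodesic : ∀ {x z xs} → WalkL G z x xs → edges (x ∷ xs) ≢ δ x x
  closed-walk-not-geodesic {x} w g = 1+n≢0 (trans (sym (edges-∷ x w)) (trans g (δ-refl x)))

  module _ (δ≡0⇒≡ : ∀ {x y} → δ x y ≡ 0 → x ≡ y)
           (descent : ∀ {x y n} → δ x y ≡ suc n → ∃ λ z → E G x z × δ z y ≡ n) where

    geodesic-exists : ∀ x y → ∃ (Geodesic x y)
    geodesic-exists x y = descend (δ x y) refl
      where
      descend : ∀ n {x} → δ x y ≡ n → ∃ λ xs → WalkL G x y xs × edges xs ≡ n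
      descend zero d with refl ← δ≡0⇒≡ d = _ , single y , refl
      descend (suc n) {x} d with descent d
      ... | z , e , dz with descend n dz
      ...   | xs , w , g = x ∷ xs , step e w , trans (edges-∷ x w) (cong suc g)

  module _ (descent-unique : ∀ {x z z′ y} → E G x z → E G x z′ →
                             suc (δ z y) ≡ δ x y → suc (δ z′ y) ≡ δ x y → z ≡ z′) where

    geodesic-unique : ∀ {x y xs ys} → Geodesic x y xs → Geodesic x y ys → xs ≡ ys
    geodesic-unique (single _ , _) (single _ , _) = refl
    geodesic-unique (single _ , _) (step e w , g) = ⊥-elim (closed-walk-not-geodesic w g)
    geodesic-unique (step e w , g) (single _ , _) = ⊥-elim (closed-walk-not-geodesic w g)
    geodesic-unique (step e w , g) (step e′ w′ , g′) with geodesic-tail e w g | geodesic-tail e′ w′ g′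
    ... | d , h | d′ , h′ with refl ← descent-unique e e′ d d′ = cong (_ ∷_) (geodesic-unique (w , h) (w′ , h′))

WordChild : List Bool → List Bool → Set
WordChild a b = ∃ λ c → b ≡ a ∷ʳ c

WordTree : Graph
WordTree = record { V = List Bool ; E = λ a b → WordChild a b ⊎ WordChild b a }

-- Strip the common prefix, then climb from one word to the branch point and descend to the other.
treeDist : List Bool → List Bool → ℕ
treeDist []          b           = length b
treeDist a           []          = length a
treeDist (true ∷ a)  (true ∷ b)  = treeDist a b
treeDist (false ∷ a) (false ∷ b) = treeDist a b
treeDist a           b           = length a + length b

treeDist-refl : ∀ a → treeDist a a ≡ 0
treeDist-refl []          = refl
treeDist-refl (true ∷ a)  = treeDist-refl a
treeDist-refl (false ∷ a) = treeDist-refl a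

treeDist≡0⇒≡ : ∀ a b → treeDist a b ≡ 0 → a ≡ b
treeDist≡0⇒≡ []          []          _ = refl
treeDist≡0⇒≡ (true ∷ a)  (true ∷ b)  d = cong (true ∷_) (treeDist≡0⇒≡ a b d)
treeDist≡0⇒≡ (false ∷ a) (false ∷ b) d = cong (false ∷_) (treeDist≡0⇒≡ a b d)

treeDist-++ : ∀ a rest → treeDist a (a ++ rest) ≡ length rest
treeDist-++ []          rest = refl
treeDist-++ (true ∷ a)  rest = treeDist-++ a rest
treeDist-++ (false ∷ a) rest = treeDist-++ a rest

length-∷ʳ : ∀ {A : Set} (a : List A) c → length (a ∷ʳ c) ≡ suc (length a)
length-∷ʳ a c = trans (length-++ a) (+-comm (length a) 1)

treeDist-child : ∀ a c t → (∃ λ rest → t ≡ a ++ c ∷ rest) ⊎ treeDist (a ∷ʳ c) t ≡ suc (treeDist a t)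
treeDist-child []          c     []          = inj₂ refl
treeDist-child []          true  (true ∷ t)  = inj₁ (t , refl)
treeDist-child []          false (false ∷ t) = inj₁ (t , refl)
treeDist-child []          true  (false ∷ t) = inj₂ refl
treeDist-child []          false (true ∷ t)  = inj₂ refl
treeDist-child (x ∷ a)     c     []          = inj₂ (cong suc (length-∷ʳ a c))
treeDist-child (true ∷ a)  c     (true ∷ t)  = Sum.map₁ (λ (rest , e) → rest , cong (true ∷_) e) (treeDist-child a c t)
treeDist-child (false ∷ a) c     (false ∷ t) = Sum.map₁ (λ (rest , e) → rest , cong (false ∷_) e) (treeDist-child a c t)
treeDist-child (true ∷ a)  c     (false ∷ t) = inj₂ (cong (λ n → suc n + suc (length t)) (length-∷ʳ a c))
treeDist-child (false ∷ a) c     (true ∷ t)  = inj₂ (cong (λ n → suc n + suc (length t)) (length-∷ʳ a c))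

treeDist-descendant : ∀ a c rest → treeDist a (a ++ c ∷ rest) ≡ suc (treeDist (a ∷ʳ c) (a ++ c ∷ rest))
treeDist-descendant a c rest = begin
  treeDist a (a ++ c ∷ rest)                   ≡⟨ treeDist-++ a (c ∷ rest) ⟩
  suc (length rest)                            ≡⟨ cong suc (treeDist-++ (a ∷ʳ c) rest) ⟨
  suc (treeDist (a ∷ʳ c) ((a ∷ʳ c) ++ rest))   ≡⟨ cong (suc ∘ treeDist (a ∷ʳ c)) (∷ʳ-++ a c rest) ⟩
  suc (treeDist (a ∷ʳ c) (a ++ c ∷ rest))      ∎
  where open ≡-Reasoning

treeDist-edge : ∀ {a b} t → E WordTree a b → treeDist a t ≤ suc (treeDist b t)
treeDist-edge {a} t (inj₁ (c , refl)) with treeDist-child a c t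
... | inj₁ (rest , refl) = ≤-reflexive (treeDist-descendant a c rest)
... | inj₂ up = ≤-trans (n≤1+n _) (≤-trans (≤-reflexive (sym up)) (n≤1+n _))
treeDist-edge {b = b} t (inj₂ (c , refl)) with treeDist-child b c t
... | inj₁ (rest , refl) = ≤-trans (n≤1+n _) (≤-trans (≤-reflexive (sym (treeDist-descendant b c rest))) (n≤1+n _))
... | inj₂ up = ≤-reflexive up

descending-child⇒descendant : ∀ a c t → suc (treeDist (a ∷ʳ c) t) ≡ treeDist a t → ∃ λ rest → t ≡ a ++ c ∷ rest
descending-child⇒descendant a c t d with treeDist-child a c t
... | inj₁ descendant = descendant
... | inj₂ up = ⊥-elim (m+1+n≢n 1 (trans (cong suc (sym up)) d))

treeDescent-unique : ∀ {a b b′ t} → E WordTree a b → E WordTree a b′ →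
                     suc (treeDist b t) ≡ treeDist a t → suc (treeDist b′ t) ≡ treeDist a t → b ≡ b′
treeDescent-unique {a} {t = t} (inj₁ (c , refl)) (inj₁ (c′ , refl)) d d′
  with descending-child⇒descendant a c t d | descending-child⇒descendant a c′ t d′
... | rest , refl | rest′ , t≡ = cong (a ∷ʳ_) (∷-injectiveˡ (++-cancelˡ a _ _ t≡))
treeDescent-unique (inj₂ (c , a≡)) (inj₂ (c′ , a≡′)) _ _ = ∷ʳ-injectiveˡ _ _ (trans (sym a≡) a≡′)
treeDescent-unique {b′ = p} (inj₁ (c , refl)) (inj₂ (c′ , refl)) d d′ = ⊥-elim (child-and-parent-descend {p} d d′)
  where
  -- t lies below p ∷ʳ c′ ∷ʳ c, so going up from p ∷ʳ c′ moves away from t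
  child-and-parent-descend : ∀ {p c′ c t} → suc (treeDist ((p ∷ʳ c′) ∷ʳ c) t) ≡ treeDist (p ∷ʳ c′) t →
                             suc (treeDist p t) ≢ treeDist (p ∷ʳ c′) t
  child-and-parent-descend {p} {c′} {c} {t} d d′ with descending-child⇒descendant (p ∷ʳ c′) c t d
  ... | rest , refl = m+1+n≢n 1 (begin
    suc (suc (suc (length rest)))          ≡⟨ cong suc (treeDist-++ p (c′ ∷ c ∷ rest)) ⟨
    suc (treeDist p (p ++ c′ ∷ c ∷ rest))  ≡⟨ cong (suc ∘ treeDist p) (∷ʳ-++ p c′ (c ∷ rest)) ⟨
    suc (treeDist p t)                     ≡⟨ d′ ⟩
    treeDist (p ∷ʳ c′) t                   ≡⟨ treeDist-++ (p ∷ʳ c′) (c ∷ rest) ⟩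
    suc (length rest)                      ∎)
    where open ≡-Reasoning
treeDescent-unique (inj₂ (c , refl)) (inj₁ (c′ , refl)) d d′ =
  sym (treeDescent-unique (inj₁ (c′ , refl)) (inj₂ (c , refl)) d′ d)

treeDescent-below : ∀ a c rest t {n} → t ≡ a ++ c ∷ rest → treeDist a t ≡ suc n →
                    ∃ λ c → treeDist (a ∷ʳ c) t ≡ n × length (a ∷ʳ c) ≤ length t
treeDescent-below a c rest _ refl d =
  c , suc-injective (trans (sym (treeDist-descendant a c rest)) d) ,
  ≤-trans (length-++-≤ˡ (a ∷ʳ c)) (≤-reflexive (cong length (∷ʳ-++ a c rest)))

treeDescent : ∀ a t {n} → treeDist a t ≡ suc n →
              (∃₂ λ p c → a ≡ p ∷ʳ c × treeDist p t ≡ n) ⊎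
              (∃ λ c → treeDist (a ∷ʳ c) t ≡ n × length (a ∷ʳ c) ≤ length t)
treeDescent a t d with initLast a
treeDescent .[] (c ∷ rest) d | [] = inj₂ (treeDescent-below [] c rest _ refl d)
treeDescent .(p ∷ʳ c) t d | p ∷ʳ′ c with treeDist-child p c t
... | inj₂ up = inj₁ (p , c , refl , suc-injective (trans (sym up) d))
... | inj₁ ([] , refl) = ⊥-elim (1+n≢0 (trans (sym d) (treeDist-refl (p ∷ʳ c))))
... | inj₁ (c′ ∷ rest , refl) = inj₂ (treeDescent-below (p ∷ʳ c) c′ rest _ (sym (∷ʳ-++ p c (c′ ∷ rest))) d)

module WordTreeGeodesics = Geodesics WordTree treeDist treeDist-refl treeDist-edge

vecOfLength : ∀ {A : Set} {n} (l : List A) → length l ≡ n → Vec A n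
vecOfLength l refl = fromList l

toList-vecOfLength : ∀ {A : Set} {n} (l : List A) (e : length l ≡ n) → toList (vecOfLength l e) ≡ l
toList-vecOfLength l refl = toList∘fromList l

reverse≡∷ʳ⇒ : ∀ {A : Set} {w p : List A} {c} → reverse w ≡ p ∷ʳ c → w ≡ c ∷ reverse p
reverse≡∷ʳ⇒ {w = w} {p} {c} e = reverse-injective (begin
  reverse w                ≡⟨ e ⟩
  p ∷ʳ c                   ≡⟨ cong (_∷ʳ c) (reverse-involutive p) ⟨
  reverse (reverse p) ∷ʳ c ≡⟨ unfold-reverse c (reverse p) ⟨
  reverse (c ∷ reverse p)  ∎)
  where open ≡-Reasoning

module _ {r : ℕ} where

  -- Positions are stored last-step-first (the children of w are b ∷ w); word reads them from the root.
  word : GTV r → List Bool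
  word (node _ w _) = reverse w
  word (leaf v)     = reverse (toList v)

  length-word-leaf : ∀ v → length (word (leaf v)) ≡ r
  length-word-leaf v = trans (length-reverse (toList v)) (length-toList v)

  word-length≤ : ∀ x → length (word x) ≤ r
  word-length≤ (node _ w p) = ≤-trans (≤-reflexive (length-reverse w)) (≤-trans (n≤1+n _) p)
  word-length≤ (leaf v)     = ≤-reflexive (length-word-leaf v)

  Child⇒WordChild : ∀ {x y} → Child x y → WordChild (word x) (word y)
  Child⇒WordChild (nn _ b w _ _)    = b , unfold-reverse b w
  Child⇒WordChild (nl _ b w _ _ eq) = b , trans (cong reverse eq) (unfold-reverse b w)

  word-edge : ∀ {x y} → E (GT r) x y → E WordTree (word x) (word y)
  word-edge = Sum.map Child⇒WordChild Child⇒WordChild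

  dist : GTV r → GTV r → ℕ
  dist x y = treeDist (word x) (word y)

  dist-edge : ∀ {x z} t → E (GT r) x z → dist x t ≤ suc (dist z t)
  dist-edge t e = treeDist-edge (word t) (word-edge e)

  module GTGeodesics = Geodesics (GT r) dist (treeDist-refl ∘ word) dist-edge
  open GTGeodesics using (Geodesic; geodesic-tail; geodesic⇒shortest; shortest⇒geodesic)

  geodesic-words-unique : ∀ {x y xs ys} → Geodesic x y xs → Geodesic x y ys → map word xs ≡ map word ys
  geodesic-words-unique γ γ′ = WordTreeGeodesics.geodesic-unique treeDescent-unique (toTree γ) (toTree γ′)
    where
    toTree : ∀ {x y xs} → Geodesic x y xs → WordTreeGeodesics.Geodesic (word x) (word y) (map word xs)
    toTree {xs = xs} (w , g) = walk-map word word-edge w , trans (edges-map word xs) g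

  node-word≢leaf-word : ∀ {w v} → length w < r → reverse w ≢ word (leaf v)
  node-word≢leaf-word {w} {v} p e = 1+n≰n (subst (λ n → suc n ≤ r) length-w≡r p)
    where
    length-w≡r : length w ≡ r
    length-w≡r = trans (sym (length-reverse w)) (trans (cong length e) (length-word-leaf v))

  word-injectiveOn : ∀ {i x y} → InCopy i x → InCopy i y → word x ≡ word y → x ≡ y
  word-injectiveOn {i} (inNode w p) (inNode w′ p′) e with refl ← reverse-injective {x = w} {y = w′} e =
    cong (node i w) (≤-irrelevant p p′)
  word-injectiveOn (inLeaf v) (inLeaf v′) e =
    cong leaf (trans (sym (cast-is-id refl v)) (toList-injective refl v v′ (reverse-injective e)))
  word-injectiveOn (inNode w p) (inLeaf v) e = ⊥-elim (node-word≢leaf-word {w} {v} p e)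
  word-injectiveOn (inLeaf v) (inNode w p) e = ⊥-elim (node-word≢leaf-word {w} {v} p (sym e))

  InCopy-irrelevant : ∀ {i} {x : GTV r} (p q : InCopy i x) → p ≡ q
  InCopy-irrelevant (inNode _ _) (inNode _ _) = refl
  InCopy-irrelevant (inLeaf _)   (inLeaf _)   = refl

  leaf-neighbours-word : ∀ {v z z′} → E (GT r) (leaf v) z → E (GT r) (leaf v) z′ → word z ≡ word z′
  leaf-neighbours-word (inj₂ (nl _ _ _ _ _ eq)) (inj₂ (nl _ _ _ _ _ eq′)) =
    cong reverse (∷-injectiveʳ (trans (sym eq) eq′))

  copy-parent : ∀ {i x p c} → InCopy i x → word x ≡ p ∷ʳ c → ∃ λ z → InCopy i z × E (GT r) x z × word z ≡ p
  copy-parent {i} {p = p} {c} (inNode w q) e with refl ← reverse≡∷ʳ⇒ {w = w} e =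
    node i (reverse p) (≤-trans (n≤1+n _) q) , inNode _ _ , inj₂ (nn i c (reverse p) _ q) , reverse-involutive p
  copy-parent {i} {p = p} {c} (inLeaf v) e =
    node i (reverse p) parent<r , inNode _ _ , inj₂ (nl i c (reverse p) parent<r v v≡) , reverse-involutive p
    where
    v≡ : toList v ≡ c ∷ reverse p
    v≡ = reverse≡∷ʳ⇒ e
    parent<r : suc (length (reverse p)) ≤ r
    parent<r = ≤-reflexive (trans (sym (cong length v≡)) (length-toList v))

  copy-child : ∀ {i x c} → InCopy i x → length (word x ∷ʳ c) ≤ r →
               ∃ λ z → InCopy i z × E (GT r) x z × word z ≡ word x ∷ʳ c
  copy-child {i} {c = c} (inNode w q) len
    with m≤n⇒m<n∨m≡n (subst (_≤ r) (trans (length-∷ʳ (reverse w) c) (cong suc (length-reverse w))) len)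
  ... | inj₁ child<r = node i (c ∷ w) child<r , inNode _ _ , inj₁ (nn i c w q child<r) , unfold-reverse c w
  ... | inj₂ child≡r =
    leaf v , inLeaf v , inj₁ (nl i c w q v (toList-vecOfLength (c ∷ w) child≡r)) ,
    trans (cong reverse (toList-vecOfLength (c ∷ w) child≡r)) (unfold-reverse c w)
    where v = vecOfLength (c ∷ w) child≡r
  copy-child {c = c} (inLeaf v) len =
    ⊥-elim (1+n≰n (subst (_≤ r) (trans (length-∷ʳ (word (leaf v)) c) (cong suc (length-word-leaf v))) len))

  Copy : Fin 2 → Graph
  Copy i = Induced (GT r) (InCopy i)

  module CopyGeodesics (i : Fin 2) =
    Geodesics (Copy i) (λ x y → dist (proj₁ x) (proj₁ y)) (treeDist-refl ∘ word ∘ proj₁)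
              (λ t → dist-edge (proj₁ t))

  copy-dist≡0⇒≡ : ∀ {i} {x y : V (Copy i)} → dist (proj₁ x) (proj₁ y) ≡ 0 → x ≡ y
  copy-dist≡0⇒≡ {x = x , px} {y , py} d with refl ← word-injectiveOn px py (treeDist≡0⇒≡ (word x) (word y) d) =
    cong (x ,_) (InCopy-irrelevant px py)

  copy-descent : ∀ {i} {x y : V (Copy i)} {n} → dist (proj₁ x) (proj₁ y) ≡ suc n →
                 ∃ λ z → E (Copy i) x z × dist (proj₁ z) (proj₁ y) ≡ n
  copy-descent {x = x , px} {y , py} d with treeDescent (word x) (word y) d
  ... | inj₁ (p , c , x≡ , d′) with copy-parent px x≡
  ...   | z , pz , e , z≡ = (z , pz) , e , trans (cong (λ a → treeDist a (word y)) z≡) d′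
  copy-descent {x = x , px} {y , py} d | inj₂ (c , d′ , len) with copy-child px (≤-trans len (word-length≤ y))
  ...   | z , pz , e , z≡ = (z , pz) , e , trans (cong (λ a → treeDist a (word y)) z≡) d′

  Copy-geodesic : ∀ i (x y : V (Copy i)) → ∃ (CopyGeodesics.Geodesic i x y)
  Copy-geodesic i = CopyGeodesics.geodesic-exists i copy-dist≡0⇒≡ (λ {x y} → copy-descent {x = x} {y})

  geodesic-within-copy : ∀ {i x y} → InCopy i x → InCopy i y → ∃ λ xs → Geodesic x y xs × All (InCopy i) xs
  geodesic-within-copy {i} px py with Copy-geodesic i (_ , px) (_ , py)
  ... | xs , w , g =
    map proj₁ xs , (walk-map proj₁ id w , trans (edges-map proj₁ xs) g) , map⁺ (universal proj₂ xs)

  copy-isometric : ∀ i → IsIsometricInduced (GT r) (InCopy i)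
  copy-isometric i (x , px) (y , py) d =
    ⇔.trans (CopyGeodesics.Dist⇔δ i (proj₂ (Copy-geodesic i _ _)))
            (⇔.sym (GTGeodesics.Dist⇔δ (proj₁ (proj₂ (geodesic-within-copy px py)))))

  -- both neighbours of a quasi-leaf carry the same word, so passing through it gains nothing
  leaf-not-interior : ∀ {x v z y xs} → E (GT r) x (leaf v) → E (GT r) (leaf v) z → WalkL (GT r) z y xs →
                      edges (x ∷ leaf v ∷ xs) ≢ dist x y
  leaf-not-interior {x} {v} {z} {y} e e′ w g with geodesic-tail e (step e′ w) g
  ... | x↘v , g′ with geodesic-tail e′ w g′
  ...   | v↘z , _ = m+1+n≢n 1 (begin
    suc (suc (dist z y))  ≡⟨ cong suc v↘z ⟩
    suc (dist (leaf v) y) ≡⟨ x↘v ⟩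
    dist x y              ≡⟨ cong (λ a → treeDist a (word y)) (leaf-neighbours-word (Sum.swap e) e′) ⟩
    dist z y              ∎)
    where open ≡-Reasoning

  geodesic-from-node-InCopy : ∀ {k w p y xs} → Geodesic (node k w p) y xs → All (InCopy k) xs
  geodesic-from-node-InCopy (single _ , _) = inNode _ _ ∷ []
  geodesic-from-node-InCopy (step e@(inj₁ (nn _ _ _ _ _)) w , g) =
    inNode _ _ ∷ geodesic-from-node-InCopy (w , proj₂ (geodesic-tail e w g))
  geodesic-from-node-InCopy (step e@(inj₂ (nn _ _ _ _ _)) w , g) =
    inNode _ _ ∷ geodesic-from-node-InCopy (w , proj₂ (geodesic-tail e w g))
  geodesic-from-node-InCopy (step (inj₁ (nl _ _ _ _ v _)) (single _) , _) = inNode _ _ ∷ inLeaf v ∷ []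
  geodesic-from-node-InCopy (step e@(inj₁ (nl _ _ _ _ _ _)) (step e′ w′) , g) =
    ⊥-elim (leaf-not-interior e e′ w′ g)

  geodesic-InOneCopy : ∀ {x y xs} → Geodesic x y xs → ∃ λ k → All (InCopy k) xs
  geodesic-InOneCopy {x = node k _ _} γ = k , geodesic-from-node-InCopy γ
  geodesic-InOneCopy {x = leaf v} (single _ , _) = 0F , inLeaf v ∷ []
  geodesic-InOneCopy {x = leaf v} (step e@(inj₂ (nl k _ _ _ _ _)) w , g) =
    k , inLeaf v ∷ geodesic-from-node-InCopy (w , proj₂ (geodesic-tail e w g))

  geodesic-InCopy : ∀ {i u v xs} → InCopy i u → InCopy i v → ¬ (QuasiLeaf u × QuasiLeaf v) →
                    Geodesic u v xs → All (InCopy i) xs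
  geodesic-InCopy (inNode _ _) _            _  γ = geodesic-from-node-InCopy γ
  geodesic-InCopy (inLeaf a)   (inLeaf b)   nq _ = ⊥-elim (nq (ql a , ql b))
  geodesic-InCopy (inLeaf a)   (inNode _ _) _  γ@(w , _) with geodesic-InOneCopy γ
  ... | k , ps with All-target w ps
  ...   | inNode _ _ = ps

  copy-geodesics-unique : ∀ {k x y xs ys} → Geodesic x y xs → Geodesic x y ys →
                          All (InCopy k) xs → All (InCopy k) ys → xs ≡ ys
  copy-geodesics-unique γ γ′ ps qs = map-injectiveOn word word-injectiveOn ps qs (geodesic-words-unique γ γ′)

  -- between distinct quasi-leaves a walk visits a non-quasi-leaf, which fixes the copy
  leaves-walk-copy-unique : ∀ {a b k k′ xs} → leaf a ≢ leaf b → WalkL (GT r) (leaf a) (leaf b) xs →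
                            All (InCopy k) xs → All (InCopy k′) xs → k ≡ k′
  leaves-walk-copy-unique a≢b (single _) _ _ = ⊥-elim (a≢b refl)
  leaves-walk-copy-unique _ (step (inj₂ (nl _ _ _ _ _ _)) (step _ _)) (_ ∷ inNode _ _ ∷ _) (_ ∷ inNode _ _ ∷ _) =
    refl

  uniqueShortest : ∀ {i u v} → InCopy i u → InCopy i v → ¬ (QuasiLeaf u × QuasiLeaf v) →
                   UniqueShortest (GT r) u v
  uniqueShortest pu pv nq with geodesic-within-copy pu pv
  ... | p , γ , p⊆i = p , geodesic⇒shortest γ , λ s s-shortest →
    let γs = shortest⇒geodesic γ s-shortest in copy-geodesics-unique γs γ (geodesic-InCopy pu pv nq γs) p⊆i

  exactlyTwoShortest : ∀ {a b} → leaf a ≢ leaf b → ExactlyTwoShortest (GT r) (leaf a) (leaf b)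
  exactlyTwoShortest {a} {b} a≢b =
    path 0F , path 1F , paths-differ , geodesic⇒shortest (geodesic 0F) , geodesic⇒shortest (geodesic 1F) , classify
    where
    within : ∀ k → ∃ λ p → Geodesic (leaf a) (leaf b) p × All (InCopy k) p
    within k = geodesic-within-copy (inLeaf a) (inLeaf b)

    path : Fin 2 → List (GTV r)
    path k = proj₁ (within k)

    geodesic : ∀ k → Geodesic (leaf a) (leaf b) (path k)
    geodesic k = proj₁ (proj₂ (within k))

    path-InCopy : ∀ k → All (InCopy k) (path k)
    path-InCopy k = proj₂ (proj₂ (within k))

    paths-differ : path 0F ≢ path 1F
    paths-differ eq with leaves-walk-copy-unique a≢b (proj₁ (geodesic 0F)) (path-InCopy 0F)
                           (subst (All (InCopy 1F)) (sym eq) (path-InCopy 1F))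
    ... | ()

    classify : ∀ s → IsShortestPath (GT r) (leaf a) (leaf b) s → s ≡ path 0F ⊎ s ≡ path 1F
    classify s s-shortest with shortest⇒geodesic (geodesic 0F) s-shortest
    ... | γ with geodesic-InOneCopy γ
    ...   | 0F , ps = inj₁ (copy-geodesics-unique γ (geodesic 0F) ps (path-InCopy 0F))
    ...   | 1F , ps = inj₂ (copy-geodesics-unique γ (geodesic 1F) ps (path-InCopy 1F))

mainTheorem1 : (r : ℕ) → 2 ≤ r → (i : Fin 2) →
    IsIsometricInduced (GT r) (InCopy i) ×
    (∀ (u v : GTV r) → InCopy i u → InCopy i v → u ≢ v →
      (QuasiLeaf u × QuasiLeaf v → ExactlyTwoShortest (GT r) u v) ×
      (¬ (QuasiLeaf u × QuasiLeaf v) → UniqueShortest (GT r) u v))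
mainTheorem1 r _ i = copy-isometric i , λ u v pu pv u≢v → twoShortest u≢v , uniqueShortest pu pv
  where
  twoShortest : ∀ {u v : GTV r} → u ≢ v → QuasiLeaf u × QuasiLeaf v → ExactlyTwoShortest (GT r) u v
  twoShortest u≢v (ql _ , ql _) = exactlyTwoShortest u≢v
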